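{- Let $q$ be a prime power and let $1\le k\le n$ be integers with $\gcd(k,n)>1$. Then $g_{q-1}$ is not $k$th order sum-free on $\mathbb F_{q^n}$.
   Context: $g_{q-1}:\mathbb F_{q^n}\to\mathbb F_{q^n}$ is defined by $g_{q-1}(x)=1/x^{q-1}$ for $x\ne 0$ and $g_{q-1}(0)=0$. A function $f:\mathbb F_{q^n}\to\mathbb F_{q^n}$ is $k$th order sum-free if $\sum_{x\in A}f(x)\ne0$ for every $k$-dimensional $\mathbb F_q$-affine subspace $A$ of $\mathbb F_{q^n}$. -}

module Defs where

open import Level using (0ℓ)
open import Data.Nat as ℕ using (ℕ; zero; suc; _∸_)
open import Data.Nat.Primality using (Prime)
open import Data.Fin using (Fin; zero; suc)
open import Data.List using (List; []; _∷_; length; filter; map; concatMap; foldr)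
open import Data.List.Membership.Propositional using (_∈_)
open import Data.List.Relation.Unary.Unique.Propositional using (Unique)
open import Data.Product using (Σ; ∃; ∃-syntax; _×_)
open import Relation.Nullary using (¬_; yes; no)
open import Relation.Binary.Definitions using (DecidableEquality)
open import Relation.Binary.PropositionalEquality using (_≡_; _≢_)
open import Algebra.Structures using (IsCommutativeRing)

IsPrimePower : ℕ → Set
IsPrimePower q = ∃[ p ] ∃[ e ] (Prime p × 1 ℕ.≤ e × q ≡ p ℕ.^ e)

record FiniteField : Set₁ where
  infixl 6 _+_
  infixl 7 _*_
  field
    Carrier   : Set
    _+_ _*_   : Carrier → Carrier → Carrier
    -_        : Carrier → Carrier
    0# 1#     : Carrier
    _⁻¹       : Carrier → Carrier
    isCommutativeRing : IsCommutativeRing _≡_ _+_ _*_ -_ 0# 1#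
    0≢1       : 0# ≢ 1#
    inverseʳ  : ∀ x → x ≢ 0# → x * (x ⁻¹) ≡ 1#
    _≟_       : DecidableEquality Carrier
    elements  : List Carrier
    complete  : ∀ x → x ∈ elements
    unique    : Unique elements

  size : ℕ
  size = length elements

  _^_ : Carrier → ℕ → Carrier
  x ^ zero  = 1#
  x ^ suc m = x * (x ^ m)

  sum : List Carrier → Carrier
  sum = foldr _+_ 0#

  ∑ : (k : ℕ) → (Fin k → Carrier) → Carrier
  ∑ zero    v = 0#
  ∑ (suc k) v = v zero + ∑ k (λ i → v (suc i))

module _ (F : FiniteField) (q : ℕ) where
  open FiniteField F

  -- the subfield F_q = { x | x^q = x } (F has q^n elements)
  Fq-elements : List Carrier
  Fq-elements = filter (λ x → (x ^ q) ≟ x) elements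

  InFq : Carrier → Set
  InFq x = x ^ q ≡ x

  tuples : {A : Set} → (k : ℕ) → List A → List (Fin k → A)
  tuples zero    xs = (λ ()) ∷ []
  tuples (suc k) xs = concatMap (λ x → map (λ t → λ { zero → x ; (suc i) → t i }) (tuples k xs)) xs

  FqIndependent : (k : ℕ) → (Fin k → Carrier) → Set
  FqIndependent k v = (c : Fin k → Carrier) → (∀ i → InFq (c i)) →
                      ∑ k (λ i → c i * v i) ≡ 0# → ∀ i → c i ≡ 0#

  -- The k-dim F_q-affine subspaces are exactly a + span_{F_q}(v₁,…,v_k) with v
  -- F_q-independent; then c ↦ a + Σ cᵢ vᵢ is a bijection F_q^k → A, so the sum
  -- over A is the sum over all c ∈ F_q^k.
  -- kth order sum-free: nonzero sum on every k-dim F_q-affine subspace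
  SumFree : (k : ℕ) → (Carrier → Carrier) → Set
  SumFree k f = (a : Carrier) (v : Fin k → Carrier) → FqIndependent k v →
                sum (map f (map (λ c → a + ∑ k (λ i → c i * v i)) (tuples k Fq-elements))) ≢ 0#

  g : Carrier → Carrier
  g x with x ≟ 0#
  ... | yes _ = 0#
  ... | no  _ = (x ^ (q ∸ 1)) ⁻¹

-- Write d = gcd k n > 1 and k = m d. When Q is a power of the characteristic p, the fixed points of
-- x ↦ x ^ Q form a subfield F_Q of F, by the Frobenius identity (x + y) ^ p = x ^ p + y ^ p; and when
-- |F| is a power of Q there are exactly Q of them: the nonzero ones are roots of X ^ (Q - 1) - 1,
-- while by Fermat the others are roots of 1 + Y + ⋯ + Y ^ t with Y = X ^ (Q - 1) and
-- |F| = 1 + (Q - 1) (t + 1). So F_q ⊊ F_{q^d} ⊆ F, and picking vectors greedily gives an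
-- F_{q^d}-subspace L of F of F_q-dimension m d = k. For α ∈ F_{q^d} outside F_q we get α L = L,
-- while g (α x) = μ g x with μ = α ^ -(q - 1) ≠ 1, so the sum of g over L is μ times itself, i.e. 0.

module Submission where

open import Level using (0ℓ)
open import Defs
open import Data.Nat as ℕ using (ℕ; zero; suc; _≤_; _<_; _∸_; z≤n; s≤s)
import Data.Nat.Properties as ℕ
open import Data.Nat.Combinatorics using (_C_; nCn≡1; nC1≡n; nCk+nC[k+1]≡[n+1]C[k+1]; k>n⇒nCk≡0)
open import Data.Nat.Divisibility using (_∣_; divides; ∣⇒≤)
open import Data.Nat.GCD using (gcd[m,n]∣m; gcd[m,n]∣n)
open import Data.Nat.Primality using (Prime; euclidsLemma; prime⇒nonZero; prime⇒nonTrivial)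
open import Data.Nat.Tactic.RingSolver using (solve-∀)
open import Data.Fin using (Fin; zero; suc; toℕ; fromℕ; inject₁)
import Data.Fin.Properties as Fin
open import Data.Product using (∃; _×_; _,_; proj₂)
open import Data.Sum using (_⊎_; inj₁; inj₂)
open import Data.List using (List; []; _∷_; [_]; length; filter; map; concatMap; foldr; replicate; _++_)
import Data.List.Properties as List
open import Data.List.Membership.Propositional using (_∈_; _∉_; find; lose)
open import Data.List.Membership.Propositional.Properties
  using (∈-filter⁺; ∈-filter⁻; ∈-map⁺; ∈-map⁻; ∈-concatMap⁺; ∈-concatMap⁻; ∈-++⁺ʳ)
open import Data.List.Membership.Propositional.Properties.WithK using (unique∧set⇒bag)
open import Data.List.Relation.Unary.All as All using (All; []; _∷_)
open import Data.List.Relation.Unary.Any as Any using (here; there)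
open import Data.List.Relation.Unary.AllPairs using ([]; _∷_)
open import Data.List.Relation.Unary.Unique.Propositional using (Unique)
import Data.List.Relation.Unary.Unique.Propositional.Properties as Unique
open import Data.List.Relation.Binary.Subset.Propositional using (_⊆_)
open import Data.List.Relation.Binary.Permutation.Propositional using (_↭_; ↭⇒↭ₛ)
import Data.List.Relation.Binary.Permutation.Propositional.Properties as ↭
open import Data.List.Relation.Binary.Permutation.Setoid.Properties using (foldr-commMonoid)
open import Data.List.Relation.Binary.BagAndSetEquality using (∼bag⇒↭)
import Data.Vec.Functional as Vector
open import Function using (_∘_)
open import Function.Bundles using (_⇔_; mk⇔)
open import Relation.Nullary using (¬_; Dec; yes; no; ¬?)
open import Relation.Nullary.Negation using (contradiction)
open import Relation.Unary using (Decidable)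
open import Relation.Unary.Properties using (∁?)
open import Relation.Binary.Definitions using (DecidableEquality)
open import Relation.Binary.PropositionalEquality hiding ([_])
import Relation.Binary.PropositionalEquality.Properties as ≡
open import Algebra.Bundles using (CommutativeRing; Semiring)
open import Algebra.Structures using (IsCommutativeRing)
import Algebra.Definitions.RawSemiring as RawSemiring
import Algebra.Definitions.RawMonoid as RawMonoid
import Algebra.Properties.Ring as RingProperties
import Algebra.Properties.CommutativeSemigroup as CommutativeSemigroupProperties
import Algebra.Properties.Semiring.Exp as Exp
import Algebra.Properties.CommutativeSemiring.Exp as CommutativeExp
import Algebra.Properties.Monoid.Mult as Mult
import Algebra.Properties.Semiring.Mult as SemiringMult
import Algebra.Properties.Semiring.Sum as SemiringSum
import Algebra.Properties.CommutativeSemiring.Binomial as Binomial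
import Algebra.Solver.Ring.NaturalCoefficients.Default as NaturalSolver

unique∧set⇒↭ : {A : Set} {xs ys : List A} → Unique xs → Unique ys →
               (∀ {z} → z ∈ xs ⇔ z ∈ ys) → xs ↭ ys
unique∧set⇒↭ u v xs⇔ys = ∼bag⇒↭ (unique∧set⇒bag u v xs⇔ys)

module _ {A : Set} (_≟_ : DecidableEquality A) where

  open import Data.List.Membership.DecPropositional _≟_ using (_∈?_)

  remove : A → List A → List A
  remove x = filter (λ y → ¬? (y ≟ x))

  ∈-remove⁺ : ∀ {x y ys} → y ∈ ys → y ≢ x → y ∈ remove x ys
  ∈-remove⁺ = ∈-filter⁺ _

  ∈-remove⁻ : ∀ {x y} ys → y ∈ remove x ys → y ∈ ys × y ≢ x
  ∈-remove⁻ ys = ∈-filter⁻ _ {xs = ys}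

  remove-unique : ∀ {x ys} → Unique ys → Unique (remove x ys)
  remove-unique = Unique.filter⁺ _

  length-remove< : ∀ {x ys} → x ∈ ys → length (remove x ys) < length ys
  length-remove< x∈ys = List.filter-notAll _ _ (Any.map (λ x≡y y≢x → y≢x (sym x≡y)) x∈ys)

  length-remove : ∀ {x ys} → Unique ys → x ∈ ys → suc (length (remove x ys)) ≡ length ys
  length-remove {x} {y ∷ ys} (y≢ys ∷ u) (here refl) with y ≟ y
  ... | yes _   = cong (suc ∘ length) (List.filter-all _ (All.map (λ y≢z z≡y → y≢z (sym z≡y)) y≢ys))
  ... | no  y≢y = contradiction refl y≢y
  length-remove {x} {y ∷ ys} (y≢ys ∷ u) (there x∈ys) with y ≟ x
  ... | yes refl = contradiction refl (All.lookup y≢ys x∈ys)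
  ... | no  _    = cong suc (length-remove u x∈ys)

  private
    ⊆-remove : ∀ {x xs ys} → x ∉ xs → xs ⊆ ys → xs ⊆ remove x ys
    ⊆-remove x∉xs xs⊆ys z∈xs = ∈-remove⁺ (xs⊆ys z∈xs) λ { refl → x∉xs z∈xs }

  unique⊆⇒length≤ : ∀ {xs ys} → Unique xs → xs ⊆ ys → length xs ≤ length ys
  unique⊆⇒length≤ {[]}     _          _     = z≤n
  unique⊆⇒length≤ {x ∷ xs} (x≢xs ∷ u) xs⊆ys = ℕ.≤-trans
    (s≤s (unique⊆⇒length≤ u (⊆-remove x∉xs (λ z∈xs → xs⊆ys (there z∈xs)))))
    (length-remove< (xs⊆ys (here refl)))
    where
    x∉xs : x ∉ _
    x∉xs x∈xs = All.lookup x≢xs x∈xs refl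

  unique⊆∧length≥⇒⊇ : ∀ {xs ys} → Unique xs → xs ⊆ ys → length ys ≤ length xs → ys ⊆ xs
  unique⊆∧length≥⇒⊇ {xs} {ys} u xs⊆ys ys≤xs {y} y∈ys with y ∈? xs
  ... | yes y∈xs = y∈xs
  ... | no  y∉xs = contradiction
    (ℕ.≤-trans ys≤xs (unique⊆⇒length≤ u (⊆-remove y∉xs xs⊆ys)))
    (ℕ.<⇒≱ (length-remove< y∈ys))

  longer⇒∃∉ : ∀ {xs ys} → Unique xs → length ys < length xs → ∃ λ x → x ∈ xs × x ∉ ys
  longer⇒∃∉ {xs} {ys} u ys<xs with Any.any? (λ x → ¬? (x ∈? ys)) xs
  ... | yes some = find some
  ... | no  none = contradiction (unique⊆⇒length≤ u xs⊆ys) (ℕ.<⇒≱ ys<xs)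
    where
    xs⊆ys : xs ⊆ ys
    xs⊆ys {x} x∈xs with x ∈? ys
    ... | yes x∈ys = x∈ys
    ... | no  x∉ys = contradiction (Any.map (λ { refl → x∉ys }) x∈xs) none

length-filter+length-filter-∁ : {A : Set} {P : A → Set} (P? : Decidable P) (xs : List A) →
  length (filter P? xs) ℕ.+ length (filter (∁? P?) xs) ≡ length xs
length-filter+length-filter-∁ P? []       = refl
length-filter+length-filter-∁ P? (x ∷ xs) with P? x
... | yes _ = cong suc (length-filter+length-filter-∁ P? xs)
... | no  _ = trans (ℕ.+-suc _ _) (cong suc (length-filter+length-filter-∁ P? xs))

length-concatMap : {A B : Set} (f : A → List B) {m : ℕ} → (∀ x → length (f x) ≡ m) →
                   ∀ xs → length (concatMap f xs) ≡ length xs ℕ.* m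
length-concatMap f f≡m []       = refl
length-concatMap f f≡m (x ∷ xs) = trans (List.length-++ (f x)) (cong₂ ℕ._+_ (f≡m x) (length-concatMap f f≡m xs))

unique-concatMap : {A B : Set} (f : A → List B) {xs : List A} → Unique xs →
                   (∀ {x} → x ∈ xs → Unique (f x)) →
                   (∀ {x y b} → x ∈ xs → y ∈ xs → b ∈ f x → b ∈ f y → x ≡ y) →
                   Unique (concatMap f xs)
unique-concatMap f {[]}     _          _        _        = []
unique-concatMap f {x ∷ xs} (x≢xs ∷ u) f-unique f-disjoint =
  Unique.++⁺ (f-unique (here refl))
    (unique-concatMap f u (f-unique ∘ there) λ y∈ z∈ → f-disjoint (there y∈) (there z∈))
    λ (b∈fx , b∈rest) → let y , y∈xs , b∈fy = find (∈-concatMap⁻ f {xs = xs} b∈rest) in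
      All.lookup x≢xs y∈xs (f-disjoint (here refl) (there y∈xs) b∈fx b∈fy)

module _ where

  open import Data.Nat using (_+_; _*_; _^_)

  [k+1]*[n+1]C[k+1]≡[n+1]*nCk : ∀ n k → suc k * (suc n C suc k) ≡ suc n * (n C k)
  [k+1]*[n+1]C[k+1]≡[n+1]*nCk zero    zero    = refl
  [k+1]*[n+1]C[k+1]≡[n+1]*nCk zero    (suc k) = begin
    suc (suc k) * (1 C suc (suc k)) ≡⟨ cong (suc (suc k) *_) (k>n⇒nCk≡0 {1} {suc (suc k)} (s≤s (s≤s z≤n))) ⟩
    suc (suc k) * 0                 ≡⟨ ℕ.*-zeroʳ (suc (suc k)) ⟩
    0                               ≡⟨ cong (1 *_) (k>n⇒nCk≡0 {0} {suc k} (s≤s z≤n)) ⟨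
    1 * (0 C suc k)                 ∎
    where open ≡-Reasoning
  [k+1]*[n+1]C[k+1]≡[n+1]*nCk (suc n) zero    =
    trans (ℕ.*-identityˡ _) (trans (nC1≡n (suc (suc n))) (sym (ℕ.*-identityʳ _)))
  [k+1]*[n+1]C[k+1]≡[n+1]*nCk (suc n) (suc k) = begin
    suc (suc k) * (suc (suc n) C suc (suc k))
      ≡⟨ cong (suc (suc k) *_) (nCk+nC[k+1]≡[n+1]C[k+1] (suc n) (suc k)) ⟨
    suc (suc k) * (suc n C suc k + suc n C suc (suc k))
      ≡⟨ split k (suc n C suc k) (suc n C suc (suc k)) ⟩
    (suc k * (suc n C suc k) + suc n C suc k) + suc (suc k) * (suc n C suc (suc k))
      ≡⟨ cong₂ (λ a b → (a + suc n C suc k) + b)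
               ([k+1]*[n+1]C[k+1]≡[n+1]*nCk n k) ([k+1]*[n+1]C[k+1]≡[n+1]*nCk n (suc k)) ⟩
    (suc n * (n C k) + suc n C suc k) + suc n * (n C suc k)
      ≡⟨ merge n (n C k) (suc n C suc k) (n C suc k) ⟩
    suc n * (n C k + n C suc k) + suc n C suc k
      ≡⟨ cong (λ a → suc n * a + suc n C suc k) (nCk+nC[k+1]≡[n+1]C[k+1] n k) ⟩
    suc n * (suc n C suc k) + suc n C suc k
      ≡⟨ ℕ.+-comm _ (suc n C suc k) ⟩
    suc (suc n) * (suc n C suc k)
      ∎
    where
    open ≡-Reasoning
    split : ∀ k a b → suc (suc k) * (a + b) ≡ (suc k * a + a) + suc (suc k) * b
    split = solve-∀
    merge : ∀ n a b c → (suc n * a + b) + suc n * c ≡ suc n * (a + c) + b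
    merge = solve-∀

  p∣pCk : ∀ {p k} → Prime p → 0 < k → k < p → p ∣ p C k
  p∣pCk {suc n} {suc k} p-prime _ (s≤s k<n)
    with euclidsLemma (suc k) (suc n C suc k) p-prime
           (divides (n C k) (trans ([k+1]*[n+1]C[k+1]≡[n+1]*nCk n k) (ℕ.*-comm (suc n) (n C k))))
  ... | inj₁ p∣k+1 = contradiction (∣⇒≤ p∣k+1) (ℕ.<⇒≱ (s≤s k<n))
  ... | inj₂ p∣pCk = p∣pCk

  [1+s]^[1+f]≡1+s*[1+t] : ∀ s f → ∃ λ t → suc s ^ suc f ≡ suc (s * suc t)
  [1+s]^[1+f]≡1+s*[1+t] s zero    = 0 , refl
  [1+s]^[1+f]≡1+s*[1+t] s (suc f) with [1+s]^[1+f]≡1+s*[1+t] s f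
  ... | t , eq = suc s * suc t , trans (cong (suc s *_) eq) (regroup s t)
    where
    regroup : ∀ s t → suc s * suc (s * suc t) ≡ suc (s * suc (suc s * suc t))
    regroup = solve-∀

  k+r≡1+s[1+t]∧r≤ts⇒1+s≤k : ∀ {k r s t} → k + r ≡ suc (s * suc t) → r ≤ t * s → suc s ≤ k
  k+r≡1+s[1+t]∧r≤ts⇒1+s≤k {k} {r} {s} {t} k+r≡ r≤ts = ℕ.+-cancelʳ-≤ (t * s) (suc s) k (begin
    suc s + t * s      ≡⟨ cong suc (trans (cong (s +_) (ℕ.*-comm t s)) (sym (ℕ.*-suc s t))) ⟩
    suc (s * suc t)    ≡⟨ k+r≡ ⟨
    k + r              ≤⟨ ℕ.+-monoʳ-≤ k r≤ts ⟩
    k + t * s          ∎)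
    where open ℕ.≤-Reasoning

module _ (F : FiniteField) where

  open FiniteField F
  open IsCommutativeRing isCommutativeRing
    using (+-assoc; +-comm; +-identityˡ; +-identityʳ; -‿inverseˡ; -‿inverseʳ;
           *-assoc; *-comm; *-identityˡ; *-identityʳ; distribˡ; distribʳ; zeroˡ; zeroʳ)
  open ≡-Reasoning

  commutativeRing : CommutativeRing 0ℓ 0ℓ
  commutativeRing = record { isCommutativeRing = isCommutativeRing }

  open CommutativeRing commutativeRing
    using (_-_; ring; semiring; commutativeSemiring; +-monoid; +-commutativeSemigroup; *-commutativeSemigroup;
           +-isCommutativeMonoid; *-isCommutativeMonoid)
  open RingProperties ring
    using (-‿distribˡ-*; -‿distribʳ-*; +-cancelˡ; +-cancelʳ; x∙y⁻¹≈ε⇒x≈y;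
           +-inverseˡ-unique; +-inverseʳ-unique; -1*x≈-x)
  open RawMonoid (CommutativeRing.+-rawMonoid commutativeRing) using () renaming (_×_ to _·_)
  open Mult +-monoid using (×-homo-1)
  open SemiringMult semiring using (×1-homo-*; ×-assoc-*)
  open NaturalSolver commutativeSemiring using (solve; _:=_; _:+_; _:*_; con)

  private
    module +-CS = CommutativeSemigroupProperties +-commutativeSemigroup
    module *-CS = CommutativeSemigroupProperties *-commutativeSemigroup

  inverseˡ : ∀ x → x ≢ 0# → x ⁻¹ * x ≡ 1#
  inverseˡ x x≢0 = trans (*-comm _ _) (inverseʳ x x≢0)

  1≢0 : 1# ≢ 0#
  1≢0 1≡0 = 0≢1 (sym 1≡0)

  *-cancelˡ : ∀ {x} y z → x ≢ 0# → x * y ≡ x * z → y ≡ z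
  *-cancelˡ {x} y z x≢0 xy≡xz = begin
    y                ≡⟨ *-identityˡ y ⟨
    1# * y           ≡⟨ cong (_* y) (inverseˡ x x≢0) ⟨
    (x ⁻¹ * x) * y   ≡⟨ *-assoc _ _ _ ⟩
    x ⁻¹ * (x * y)   ≡⟨ cong (x ⁻¹ *_) xy≡xz ⟩
    x ⁻¹ * (x * z)   ≡⟨ *-assoc _ _ _ ⟨
    (x ⁻¹ * x) * z   ≡⟨ cong (_* z) (inverseˡ x x≢0) ⟩
    1# * z           ≡⟨ *-identityˡ z ⟩
    z                ∎

  x*y≡0⇒x≡0∨y≡0 : ∀ x y → x * y ≡ 0# → x ≡ 0# ⊎ y ≡ 0#
  x*y≡0⇒x≡0∨y≡0 x y xy≡0 with x ≟ 0#
  ... | yes x≡0 = inj₁ x≡0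
  ... | no  x≢0 = inj₂ (*-cancelˡ y 0# x≢0 (trans xy≡0 (sym (zeroʳ x))))

  x≢0∧y≢0⇒x*y≢0 : ∀ {x y} → x ≢ 0# → y ≢ 0# → x * y ≢ 0#
  x≢0∧y≢0⇒x*y≢0 {x} {y} x≢0 y≢0 xy≡0 with x*y≡0⇒x≡0∨y≡0 x y xy≡0
  ... | inj₁ x≡0 = x≢0 x≡0
  ... | inj₂ y≡0 = y≢0 y≡0

  ⁻¹-unique : ∀ x y → x * y ≡ 1# → y ≡ x ⁻¹
  ⁻¹-unique x y xy≡1 with x ≟ 0#
  ... | yes refl = contradiction (trans (sym xy≡1) (zeroˡ y)) 1≢0
  ... | no  x≢0  = *-cancelˡ y (x ⁻¹) x≢0 (trans xy≡1 (sym (inverseʳ x x≢0)))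

  ⁻¹-distrib-* : ∀ x y → x ≢ 0# → y ≢ 0# → (x * y) ⁻¹ ≡ x ⁻¹ * y ⁻¹
  ⁻¹-distrib-* x y x≢0 y≢0 = sym (⁻¹-unique (x * y) (x ⁻¹ * y ⁻¹) (begin
    (x * y) * (x ⁻¹ * y ⁻¹)   ≡⟨ *-CS.interchange x y (x ⁻¹) (y ⁻¹) ⟩
    (x * x ⁻¹) * (y * y ⁻¹)   ≡⟨ cong₂ _*_ (inverseʳ x x≢0) (inverseʳ y y≢0) ⟩
    1# * 1#                   ≡⟨ *-identityˡ 1# ⟩
    1#                        ∎))

  private
    module RS = RawSemiring (Semiring.rawSemiring semiring)

    ^≡^ : ∀ x n → x ^ n ≡ x RS.^ n
    ^≡^ x zero    = refl
    ^≡^ x (suc n) = cong (x *_) (^≡^ x n)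

  ^-assocʳ : ∀ x m n → (x ^ m) ^ n ≡ x ^ (m ℕ.* n)
  ^-assocʳ x m n = begin
    (x ^ m) ^ n        ≡⟨ ^≡^ (x ^ m) n ⟩
    (x ^ m) RS.^ n     ≡⟨ cong (RS._^ n) (^≡^ x m) ⟩
    (x RS.^ m) RS.^ n  ≡⟨ Exp.^-assocʳ semiring x m n ⟩
    x RS.^ (m ℕ.* n)   ≡⟨ ^≡^ x (m ℕ.* n) ⟨
    x ^ (m ℕ.* n)      ∎

  ^-distrib-* : ∀ x y n → (x * y) ^ n ≡ x ^ n * y ^ n
  ^-distrib-* x y n = trans (^≡^ (x * y) n)
    (trans (CommutativeExp.^-distrib-* commutativeSemiring x y n) (sym (cong₂ _*_ (^≡^ x n) (^≡^ y n))))

  1^n≡1 : ∀ n → 1# ^ n ≡ 1#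
  1^n≡1 zero    = refl
  1^n≡1 (suc n) = trans (*-identityˡ _) (1^n≡1 n)

  x^n≡0⇒x≡0 : ∀ {x} n → x ^ n ≡ 0# → x ≡ 0#
  x^n≡0⇒x≡0 zero    1≡0   = contradiction 1≡0 1≢0
  x^n≡0⇒x≡0 {x} (suc n) x*xⁿ≡0 with x*y≡0⇒x≡0∨y≡0 x _ x*xⁿ≡0
  ... | inj₁ x≡0  = x≡0
  ... | inj₂ xⁿ≡0 = x^n≡0⇒x≡0 n xⁿ≡0

  x≢0⇒x^n≢0 : ∀ {x} n → x ≢ 0# → x ^ n ≢ 0#
  x≢0⇒x^n≢0 n x≢0 xⁿ≡0 = x≢0 (x^n≡0⇒x≡0 n xⁿ≡0)

  ⁻¹-^ : ∀ x n → x ≢ 0# → (x ⁻¹) ^ n ≡ (x ^ n) ⁻¹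
  ⁻¹-^ x n x≢0 = ⁻¹-unique (x ^ n) ((x ⁻¹) ^ n) (begin
    x ^ n * (x ⁻¹) ^ n   ≡⟨ ^-distrib-* x (x ⁻¹) n ⟨
    (x * x ⁻¹) ^ n       ≡⟨ cong (_^ n) (inverseʳ x x≢0) ⟩
    1# ^ n               ≡⟨ 1^n≡1 n ⟩
    1#                   ∎)

  product : List Carrier → Carrier
  product = foldr _*_ 1#

  sum-↭ : ∀ {xs ys} → xs ↭ ys → sum xs ≡ sum ys
  sum-↭ xs↭ys = foldr-commMonoid (≡.setoid Carrier) +-isCommutativeMonoid (↭⇒↭ₛ xs↭ys)

  product-↭ : ∀ {xs ys} → xs ↭ ys → product xs ≡ product ys
  product-↭ xs↭ys = foldr-commMonoid (≡.setoid Carrier) *-isCommutativeMonoid (↭⇒↭ₛ xs↭ys)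

  sum-map-+ : ∀ x xs → sum (map (x +_) xs) ≡ length xs · x + sum xs
  sum-map-+ x []       = sym (+-identityˡ 0#)
  sum-map-+ x (y ∷ ys) = begin
    (x + y) + sum (map (x +_) ys)        ≡⟨ cong ((x + y) +_) (sum-map-+ x ys) ⟩
    (x + y) + (length ys · x + sum ys)   ≡⟨ +-CS.interchange x y _ _ ⟩
    (x + length ys · x) + (y + sum ys)   ∎

  sum-map-* : ∀ a xs → sum (map (a *_) xs) ≡ a * sum xs
  sum-map-* a []       = sym (zeroʳ a)
  sum-map-* a (x ∷ xs) = trans (cong (a * x +_) (sum-map-* a xs)) (sym (distribˡ a x _))

  product-map-* : ∀ x xs → product (map (x *_) xs) ≡ x ^ length xs * product xs
  product-map-* x []       = sym (*-identityˡ 1#)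
  product-map-* x (y ∷ ys) = begin
    (x * y) * product (map (x *_) ys)            ≡⟨ cong ((x * y) *_) (product-map-* x ys) ⟩
    (x * y) * (x ^ length ys * product ys)       ≡⟨ *-CS.interchange x y _ _ ⟩
    (x * x ^ length ys) * (y * product ys)       ∎

  -- Characteristic, Frobenius and Fermat

  size·x≡0 : ∀ x → size · x ≡ 0#
  size·x≡0 x = +-cancelˡ (sum elements) _ _ (begin
    sum elements + size · x            ≡⟨ +-comm _ _ ⟩
    size · x + sum elements            ≡⟨ sum-map-+ x elements ⟨
    sum (map (x +_) elements)          ≡⟨ sum-↭ x+elements↭elements ⟩
    sum elements                       ≡⟨ +-identityʳ _ ⟨
    sum elements + 0#                  ∎)
    where
    x+-injective : ∀ {y z} → x + y ≡ x + z → y ≡ z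
    x+-injective = +-cancelˡ x _ _
    x+elements↭elements : map (x +_) elements ↭ elements
    x+elements↭elements = unique∧set⇒↭ (Unique.map⁺ x+-injective unique) unique
      (λ {z} → mk⇔ (λ _ → complete _)
        (λ _ → subst (_∈ map (x +_) elements) (x+[-x+z]≡z z) (∈-map⁺ _ (complete (- x + z)))))
      where
      x+[-x+z]≡z : ∀ z → x + (- x + z) ≡ z
      x+[-x+z]≡z z = trans (sym (+-assoc x (- x) z)) (trans (cong (_+ z) (-‿inverseʳ x)) (+-identityˡ z))

  ·1-homo-^ : ∀ p m → (p ℕ.^ m) · 1# ≡ (p · 1#) ^ m
  ·1-homo-^ p zero    = +-identityʳ 1#
  ·1-homo-^ p (suc m) = trans (×1-homo-* p (p ℕ.^ m)) (cong ((p · 1#) *_) (·1-homo-^ p m))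

  size≡p^m⇒p·1≡0 : ∀ {p m} → size ≡ p ℕ.^ m → p · 1# ≡ 0#
  size≡p^m⇒p·1≡0 {p} {m} size≡p^m = x^n≡0⇒x≡0 m (begin
    (p · 1#) ^ m      ≡⟨ ·1-homo-^ p m ⟨
    (p ℕ.^ m) · 1#    ≡⟨ cong (_· 1#) size≡p^m ⟨
    size · 1#         ≡⟨ size·x≡0 1# ⟩
    0#                ∎)

  p∣n⇒n·x≡0 : ∀ {p n} x → p · 1# ≡ 0# → p ∣ n → n · x ≡ 0#
  p∣n⇒n·x≡0 {p} x p·1≡0 (divides j refl) = begin
    (j ℕ.* p) · x                ≡⟨ cong ((j ℕ.* p) ·_) (*-identityˡ x) ⟨
    (j ℕ.* p) · (1# * x)         ≡⟨ ×-assoc-* (j ℕ.* p) 1# x ⟨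
    ((j ℕ.* p) · 1#) * x         ≡⟨ cong (_* x) (×1-homo-* j p) ⟩
    ((j · 1#) * (p · 1#)) * x    ≡⟨ cong (λ c → ((j · 1#) * c) * x) p·1≡0 ⟩
    ((j · 1#) * 0#) * x          ≡⟨ cong (_* x) (zeroʳ _) ⟩
    0# * x                       ≡⟨ zeroˡ x ⟩
    0#                           ∎

  frobenius : ∀ {p} → Prime p → p · 1# ≡ 0# → ∀ x y → (x + y) ^ p ≡ x ^ p + y ^ p
  -- only the outer terms of the binomial expansion survive, as p ∣ p C k for 0 < k < p
  frobenius {p@(suc (suc m))} p-prime p·1≡0 x y = begin
    (x + y) ^ p                            ≡⟨ ^≡^ (x + y) p ⟩
    (x + y) RS.^ p                         ≡⟨ B.theorem p x y ⟩
    t zero + MS.sum (λ i → t (suc i))      ≡⟨ cong (t zero +_) (MS.sum-init-last (λ i → t (suc i))) ⟩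
    t zero + (MS.sum (λ i → t (suc (inject₁ i))) + t (fromℕ p))
      ≡⟨ cong (λ s → t zero + (s + t (fromℕ p))) (trans (MS.sum-cong-≗ middle) (MS.sum-replicate-zero (suc m))) ⟩
    t zero + (0# + t (fromℕ p))            ≡⟨ cong₂ (λ a b → a + b) first (trans (+-identityˡ _) last) ⟩
    y ^ p + x ^ p                          ≡⟨ +-comm _ _ ⟩
    x ^ p + y ^ p                          ∎
    where
    module B = Binomial commutativeSemiring
    module MS = SemiringSum semiring
    t : Fin (suc p) → Carrier
    t = B.binomialTerm x y p
    first : t zero ≡ y ^ p
    first = trans (×-homo-1 _) (trans (*-identityˡ _) (sym (^≡^ y p)))
    last : t (fromℕ p) ≡ x ^ p
    last = begin
      t (fromℕ p)
        ≡⟨ cong (λ k → (p C k) · (x RS.^ k * y RS.^ (p ∸ k))) (Fin.toℕ-fromℕ p) ⟩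
      (p C p) · (x RS.^ p * y RS.^ (p ∸ p))
        ≡⟨ cong₂ (λ c e → c · (x RS.^ p * y RS.^ e)) (nCn≡1 p) (ℕ.n∸n≡0 p) ⟩
      1 · (x RS.^ p * 1#)                        ≡⟨ trans (×-homo-1 _) (*-identityʳ _) ⟩
      x RS.^ p                                   ≡⟨ ^≡^ x p ⟨
      x ^ p                                      ∎
    middle : ∀ i → t (suc (inject₁ i)) ≡ 0#
    middle i = p∣n⇒n·x≡0 _ p·1≡0 (p∣pCk p-prime (s≤s z≤n) (s≤s (s≤s k≤m)))
      where
      k≤m : toℕ (inject₁ i) ≤ m
      k≤m = subst (_≤ m) (sym (Fin.toℕ-inject₁ i)) (ℕ.≤-pred (Fin.toℕ<n i))

  Additive : ℕ → Set
  Additive n = ∀ x y → (x + y) ^ n ≡ x ^ n + y ^ n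

  additive-* : ∀ {m n} → Additive m → Additive n → Additive (m ℕ.* n)
  additive-* {m} {n} +ᵐ +ⁿ x y = begin
    (x + y) ^ (m ℕ.* n)               ≡⟨ ^-assocʳ (x + y) m n ⟨
    ((x + y) ^ m) ^ n                 ≡⟨ cong (_^ n) (+ᵐ x y) ⟩
    (x ^ m + y ^ m) ^ n               ≡⟨ +ⁿ (x ^ m) (y ^ m) ⟩
    (x ^ m) ^ n + (y ^ m) ^ n         ≡⟨ cong₂ _+_ (^-assocʳ x m n) (^-assocʳ y m n) ⟩
    x ^ (m ℕ.* n) + y ^ (m ℕ.* n)     ∎

  frobenius-^ : ∀ {p} → Prime p → p · 1# ≡ 0# → ∀ j → Additive (p ℕ.^ j)
  frobenius-^ p-prime p·1≡0 zero    x y = trans (*-identityʳ _) (sym (cong₂ _+_ (*-identityʳ x) (*-identityʳ y)))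
  frobenius-^ {p} p-prime p·1≡0 (suc j) =
    additive-* {p} {p ℕ.^ j} (frobenius p-prime p·1≡0) (frobenius-^ p-prime p·1≡0 j)

  x⁻¹≢0 : ∀ {x} → x ≢ 0# → x ⁻¹ ≢ 0#
  x⁻¹≢0 {x} x≢0 x⁻¹≡0 = 1≢0 (trans (sym (inverseʳ x x≢0)) (trans (cong (x *_) x⁻¹≡0) (zeroʳ x)))

  x*[x⁻¹*y]≡y : ∀ {x} y → x ≢ 0# → x * (x ⁻¹ * y) ≡ y
  x*[x⁻¹*y]≡y {x} y x≢0 = trans (sym (*-assoc _ _ _)) (trans (cong (_* y) (inverseʳ x x≢0)) (*-identityˡ y))

  scaling-↭ : ∀ {a xs} → a ≢ 0# → Unique xs →
              (∀ {x} → x ∈ xs → a * x ∈ xs) → (∀ {x} → x ∈ xs → a ⁻¹ * x ∈ xs) → map (a *_) xs ↭ xs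
  scaling-↭ {a} {xs} a≢0 xs-unique a*-closed a⁻¹*-closed =
    unique∧set⇒↭ (Unique.map⁺ (*-cancelˡ _ _ a≢0) xs-unique) xs-unique (mk⇔ to from)
    where
    to : ∀ {y} → y ∈ map (a *_) xs → y ∈ xs
    to y∈ with ∈-map⁻ (a *_) y∈
    ... | x , x∈xs , refl = a*-closed x∈xs
    from : ∀ {y} → y ∈ xs → y ∈ map (a *_) xs
    from {y} y∈xs = subst (_∈ map (a *_) xs) (x*[x⁻¹*y]≡y y a≢0) (∈-map⁺ (a *_) (a⁻¹*-closed y∈xs))

  units : List Carrier
  units = remove _≟_ 0# elements

  suc-length-units : suc (length units) ≡ size
  suc-length-units = length-remove _≟_ unique (complete 0#)

  fermat : ∀ {x} → x ≢ 0# → x ^ length units ≡ 1#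
  fermat {x} x≢0 = *-cancelˡ _ _ (product≢0 units ∈units⇒≢0) (begin
    product units * x ^ length units    ≡⟨ *-comm _ _ ⟩
    x ^ length units * product units    ≡⟨ product-map-* x units ⟨
    product (map (x *_) units)          ≡⟨ product-↭ (scaling-↭ x≢0 units-unique x*-closed x⁻¹*-closed) ⟩
    product units                       ≡⟨ *-identityʳ _ ⟨
    product units * 1#                  ∎)
    where
    units-unique : Unique units
    units-unique = remove-unique _≟_ unique
    ∈units⇒≢0 : ∀ {y} → y ∈ units → y ≢ 0#
    ∈units⇒≢0 {y} y∈units = proj₂ (∈-remove⁻ _≟_ elements y∈units)
    product≢0 : ∀ ys → (∀ {y} → y ∈ ys → y ≢ 0#) → product ys ≢ 0#
    product≢0 []       _    = 1≢0
    product≢0 (y ∷ ys) ys≢0 = x≢0∧y≢0⇒x*y≢0 (ys≢0 (here refl)) (product≢0 ys (ys≢0 ∘ there))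
    x*-closed : ∀ {y} → y ∈ units → x * y ∈ units
    x*-closed y∈ = ∈-remove⁺ _≟_ (complete _) (x≢0∧y≢0⇒x*y≢0 x≢0 (∈units⇒≢0 y∈))
    x⁻¹*-closed : ∀ {y} → y ∈ units → x ⁻¹ * y ∈ units
    x⁻¹*-closed y∈ = ∈-remove⁺ _≟_ (complete _) (x≢0∧y≢0⇒x*y≢0 (x⁻¹≢0 x≢0) (∈units⇒≢0 y∈))

  -- Polynomials and their roots

  -- a polynomial is the list of its coefficients, constant term first
  eval : List Carrier → Carrier → Carrier
  eval []       x = 0#
  eval (c ∷ cs) x = c + x * eval cs x

  IsZero : List Carrier → Set
  IsZero = All (_≡ 0#)

  -- the quotient of c ∷ cs by X - a, which does not depend on c
  quotient : Carrier → List Carrier → List Carrier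
  quotient a []       = []
  quotient a (c ∷ cs) = eval (c ∷ cs) a ∷ quotient a cs

  length-quotient : ∀ a cs → length (quotient a cs) ≡ length cs
  length-quotient a []       = refl
  length-quotient a (c ∷ cs) = cong suc (length-quotient a cs)

  factor-theorem : ∀ a c cs x → eval (c ∷ cs) x ≡ (x - a) * eval (quotient a cs) x + eval (c ∷ cs) a
  factor-theorem a c []        x = begin
    c + x * 0#                 ≡⟨ cong (c +_) (zeroʳ x) ⟩
    c + 0#                     ≡⟨ +-identityˡ _ ⟨
    0# + (c + 0#)              ≡⟨ cong₂ (λ u v → u + (c + v)) (zeroʳ (x - a)) (zeroʳ a) ⟨
    (x - a) * 0# + (c + a * 0#) ∎
  factor-theorem a c (c′ ∷ cs) x = begin
    c + x * P x                                 ≡⟨ cong (λ p → c + x * p) (factor-theorem a c′ cs x) ⟩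
    c + x * ((x - a) * Q + P a)                 ≡⟨ cong (c +_) (distribˡ x _ (P a)) ⟩
    c + (x * ((x - a) * Q) + x * P a)           ≡⟨ cong (λ y → c + (x * ((x - a) * Q) + y * P a)) x≡[x-a]+a ⟩
    c + (x * ((x - a) * Q) + ((x - a) + a) * P a) ≡⟨ regroup c x (x - a) Q (P a) a ⟩
    (x - a) * (P a + x * Q) + (c + a * P a)     ∎
    where
    P : Carrier → Carrier
    P = eval (c′ ∷ cs)
    Q : Carrier
    Q = eval (quotient a cs) x
    x≡[x-a]+a : x ≡ (x - a) + a
    x≡[x-a]+a = sym (trans (+-assoc x (- a) a) (trans (cong (x +_) (-‿inverseˡ a)) (+-identityʳ x)))
    regroup : ∀ c x u Q P a → c + (x * (u * Q) + (u + a) * P) ≡ u * (P + x * Q) + (c + a * P)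
    regroup = solve 6 (λ c x u Q P a → c :+ (x :* (u :* Q) :+ (u :+ a) :* P) := u :* (P :+ x :* Q) :+ (c :+ a :* P)) refl

  private
    constant≡0 : ∀ a c cs → eval cs a ≡ 0# → eval (c ∷ cs) a ≡ 0# → c ≡ 0#
    constant≡0 a c cs cs[a]≡0 p[a]≡0 = begin
      c                  ≡⟨ +-identityʳ c ⟨
      c + 0#             ≡⟨ cong (c +_) (trans (cong (a *_) cs[a]≡0) (zeroʳ a)) ⟨
      c + a * eval cs a  ≡⟨ p[a]≡0 ⟩
      0#                 ∎

  quotient-isZero : ∀ a c cs → eval (c ∷ cs) a ≡ 0# → IsZero (quotient a cs) → IsZero (c ∷ cs)
  quotient-isZero a c []        p[a]≡0 []           = constant≡0 a c [] refl p[a]≡0 ∷ []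
  quotient-isZero a c (c′ ∷ cs) p[a]≡0 (q≡0 ∷ qs≡0) =
    constant≡0 a c (c′ ∷ cs) q≡0 p[a]≡0 ∷ quotient-isZero a c′ cs q≡0 qs≡0

  roots≤degree : ∀ c cs {rs} → ¬ IsZero (c ∷ cs) → Unique rs → All (λ r → eval (c ∷ cs) r ≡ 0#) rs →
                 length rs ≤ length cs
  roots≤degree c cs        {[]}     _   _           _                  = z≤n
  roots≤degree c []        {a ∷ _}  p≢0 _           (p[a]≡0 ∷ _)       =
    contradiction (quotient-isZero a c [] p[a]≡0 []) p≢0
  roots≤degree c (c′ ∷ cs) {a ∷ as} p≢0 (a≢as ∷ u) (p[a]≡0 ∷ p[as]≡0) =
    s≤s (subst (length as ≤_) (length-quotient a cs) (roots≤degree _ (quotient a cs) q≢0 u q[as]≡0))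
    where
    q≢0 : ¬ IsZero (quotient a (c′ ∷ cs))
    q≢0 q≡0 = p≢0 (quotient-isZero a c (c′ ∷ cs) p[a]≡0 q≡0)
    q[b]≡0 : ∀ {b} → a ≢ b → eval (c ∷ c′ ∷ cs) b ≡ 0# → eval (quotient a (c′ ∷ cs)) b ≡ 0#
    q[b]≡0 {b} a≢b p[b]≡0 with x*y≡0⇒x≡0∨y≡0 (b - a) (eval (quotient a (c′ ∷ cs)) b) (begin
      (b - a) * Q b            ≡⟨ +-identityʳ _ ⟨
      (b - a) * Q b + 0#       ≡⟨ cong ((b - a) * Q b +_) p[a]≡0 ⟨
      (b - a) * Q b + P a      ≡⟨ factor-theorem a c (c′ ∷ cs) b ⟨
      P b                      ≡⟨ p[b]≡0 ⟩
      0#                       ∎)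
      where
      P Q : Carrier → Carrier
      P = eval (c ∷ c′ ∷ cs)
      Q = eval (quotient a (c′ ∷ cs))
    ... | inj₁ b-a≡0 = contradiction (sym (x∙y⁻¹≈ε⇒x≈y b a b-a≡0)) a≢b
    ... | inj₂ q[b]≡0 = q[b]≡0
    q[as]≡0 : All (λ r → eval (quotient a (c′ ∷ cs)) r ≡ 0#) as
    q[as]≡0 = All.zipWith (λ (a≢b , p[b]≡0) → q[b]≡0 a≢b p[b]≡0) (a≢as , p[as]≡0)

  -- Counting the fixed points of x ↦ x ^ Q

  eval-shift : ∀ m p x → eval (replicate m 0# ++ p) x ≡ x ^ m * eval p x
  eval-shift zero    p x = sym (*-identityˡ _)
  eval-shift (suc m) p x = begin
    0# + x * eval (replicate m 0# ++ p) x  ≡⟨ +-identityˡ _ ⟩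
    x * eval (replicate m 0# ++ p) x       ≡⟨ cong (x *_) (eval-shift m p x) ⟩
    x * (x ^ m * eval p x)                 ≡⟨ *-assoc _ _ _ ⟨
    x ^ suc m * eval p x                   ∎

  X^[1+n]-1 : ℕ → List Carrier
  X^[1+n]-1 n = - 1# ∷ replicate n 0# ++ [ 1# ]

  eval-X^[1+n]-1 : ∀ n x → eval (X^[1+n]-1 n) x ≡ - 1# + x ^ suc n
  eval-X^[1+n]-1 n x = cong (- 1# +_) (begin
    x * eval (replicate n 0# ++ [ 1# ]) x   ≡⟨ cong (x *_) (eval-shift n [ 1# ] x) ⟩
    x * (x ^ n * (1# + x * 0#))             ≡⟨ cong (λ e → x * (x ^ n * (1# + e))) (zeroʳ x) ⟩
    x * (x ^ n * (1# + 0#))                 ≡⟨ cong (λ e → x * (x ^ n * e)) (+-identityʳ 1#) ⟩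
    x * (x ^ n * 1#)                        ≡⟨ cong (x *_) (*-identityʳ _) ⟩
    x ^ suc n                               ∎)

  -- 1 + Y + ⋯ + Y ^ t for Y = X ^ (1 + n), without its constant term 1
  geometric : ℕ → ℕ → List Carrier
  geometric n zero    = []
  geometric n (suc t) = replicate n 0# ++ 1# ∷ geometric n t

  length-geometric : ∀ n t → length (geometric n t) ≡ t ℕ.* suc n
  length-geometric n zero    = refl
  length-geometric n (suc t) = begin
    length (replicate n 0# ++ 1# ∷ geometric n t)
      ≡⟨ List.length-++ (replicate n 0#) ⟩
    length (replicate n 0#) ℕ.+ suc (length (geometric n t))
      ≡⟨ cong₂ (λ a b → a ℕ.+ suc b) (List.length-replicate n) (length-geometric n t) ⟩
    n ℕ.+ suc (t ℕ.* suc n)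
      ≡⟨ ℕ.+-suc n _ ⟩
    suc t ℕ.* suc n
      ∎

  geometric-identity : ∀ n t x → let y = x ^ suc n; G = eval (1# ∷ geometric n t) x in
                       y * G + 1# ≡ y ^ suc t + G
  geometric-identity n zero    x =
    trans (cong (λ G → x ^ suc n * G + 1#) G≡1) (cong (x ^ suc n * 1# +_) (sym G≡1))
    where
    G≡1 : 1# + x * 0# ≡ 1#
    G≡1 = trans (cong (1# +_) (zeroʳ x)) (+-identityʳ 1#)
  geometric-identity n (suc t) x = begin
    y * (1# + x * eval (replicate n 0# ++ 1# ∷ geometric n t) x) + 1#
      ≡⟨ cong (λ e → y * (1# + e) + 1#) (trans (cong (x *_) (eval-shift n _ x)) (sym (*-assoc x _ _))) ⟩
    y * (1# + y * G) + 1#              ≡⟨ cong (λ e → y * e + 1#) (+-comm 1# _) ⟩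
    y * (y * G + 1#) + 1#              ≡⟨ cong (λ e → y * e + 1#) (geometric-identity n t x) ⟩
    y * (y ^ suc t + G) + 1#           ≡⟨ regroup y (y ^ suc t) G ⟩
    y * y ^ suc t + (1# + y * G)
      ≡⟨ cong (λ e → y * y ^ suc t + (1# + e)) (trans (cong (x *_) (eval-shift n _ x)) (sym (*-assoc x _ _))) ⟨
    y ^ suc (suc t) + (1# + x * eval (replicate n 0# ++ 1# ∷ geometric n t) x) ∎
    where
    y G : Carrier
    y = x ^ suc n
    G = eval (1# ∷ geometric n t) x
    regroup : ∀ y Y G → y * (Y + G) + 1# ≡ y * Y + (1# + y * G)
    regroup = solve 3 (λ y Y G → y :* (Y :+ G) :+ con 1 := y :* Y :+ (con 1 :+ y :* G)) refl

  x^q≢x⇒x≢0 : ∀ q {x} → 1 ≤ q → x ^ q ≢ x → x ≢ 0#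
  x^q≢x⇒x≢0 (suc q) _ x^q≢x refl = x^q≢x (zeroˡ _)

  ∈-Fq-elements⁺ : ∀ Q {x} → InFq F Q x → x ∈ Fq-elements F Q
  ∈-Fq-elements⁺ Q {x} = ∈-filter⁺ _ (complete x)

  ∈-Fq-elements⁻ : ∀ Q {x} → x ∈ Fq-elements F Q → InFq F Q x
  ∈-Fq-elements⁻ Q x∈ = proj₂ (∈-filter⁻ _ {xs = elements} x∈)

  0∈Fq-elements : ∀ Q → 1 ≤ Q → 0# ∈ Fq-elements F Q
  0∈Fq-elements (suc Q) _ = ∈-Fq-elements⁺ (suc Q) (zeroˡ _)

  private
    X^[1+n]-1≢0 : ∀ n → ¬ IsZero (X^[1+n]-1 n)
    X^[1+n]-1≢0 n (_ ∷ zeros) = 1≢0 (All.lookup zeros (∈-++⁺ʳ (replicate n 0#) (here refl)))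

    length-X^[1+n]-1 : ∀ n → length (replicate n 0# ++ [ 1# ]) ≡ suc n
    length-X^[1+n]-1 n =
      trans (List.length-++ (replicate n 0#)) (trans (cong (ℕ._+ 1) (List.length-replicate n)) (ℕ.+-comm n 1))

    nonzero-fixed-root : ∀ n {x} → x ≢ 0# → x ^ suc (suc n) ≡ x → eval (X^[1+n]-1 n) x ≡ 0#
    nonzero-fixed-root n {x} x≢0 x^Q≡x = begin
      eval (X^[1+n]-1 n) x   ≡⟨ eval-X^[1+n]-1 n x ⟩
      - 1# + x ^ suc n       ≡⟨ cong (- 1# +_) (*-cancelˡ _ _ x≢0 (trans x^Q≡x (sym (*-identityʳ x)))) ⟩
      - 1# + 1#              ≡⟨ -‿inverseˡ 1# ⟩
      0#                     ∎

  length-Fq-elements≤ : ∀ s → length (Fq-elements F (suc (suc s))) ≤ suc (suc s)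
  length-Fq-elements≤ s =
    subst (_≤ suc (suc s)) (length-remove _≟_ K-unique (0∈Fq-elements (suc (suc s)) (s≤s z≤n)))
    (s≤s (subst (length (remove _≟_ 0# K) ≤_) (length-X^[1+n]-1 s)
      (roots≤degree _ _ (X^[1+n]-1≢0 s) (remove-unique _≟_ K-unique) (All.tabulate root))))
    where
    K : List Carrier
    K = Fq-elements F (suc (suc s))
    K-unique : Unique K
    K-unique = Unique.filter⁺ _ unique
    root : ∀ {x} → x ∈ remove _≟_ 0# K → eval (X^[1+n]-1 s) x ≡ 0#
    root x∈ = let x∈K , x≢0 = ∈-remove⁻ _≟_ K x∈ in
      nonzero-fixed-root s x≢0 (∈-Fq-elements⁻ (suc (suc s)) x∈K)

  private
    nonfixed-root : ∀ s t → size ≡ suc (suc s ℕ.* suc t) →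
                    ∀ {x} → x ^ suc (suc s) ≢ x → eval (1# ∷ geometric s t) x ≡ 0#
    nonfixed-root s t size≡ {x} x^Q≢x with eval (1# ∷ geometric s t) x ≟ 0#
    ... | yes G≡0 = G≡0
    ... | no  G≢0 = contradiction x^Q≡x x^Q≢x
      where
      y G : Carrier
      y = x ^ suc s
      G = eval (1# ∷ geometric s t) x
      x≢0 : x ≢ 0#
      x≢0 = x^q≢x⇒x≢0 (suc (suc s)) (s≤s z≤n) x^Q≢x
      y^[1+t]≡1 : y ^ suc t ≡ 1#
      y^[1+t]≡1 = trans (^-assocʳ x (suc s) (suc t))
        (trans (cong (x ^_) (ℕ.suc-injective (trans (sym size≡) (sym suc-length-units)))) (fermat x≢0))
      y*G≡G : y * G ≡ G
      y*G≡G = +-cancelʳ 1# _ _ (begin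
        y * G + 1#       ≡⟨ geometric-identity s t x ⟩
        y ^ suc t + G    ≡⟨ cong (_+ G) y^[1+t]≡1 ⟩
        1# + G           ≡⟨ +-comm 1# G ⟩
        G + 1#           ∎)
      y≡1 : y ≡ 1#
      y≡1 = *-cancelˡ y 1# G≢0 (trans (*-comm G y) (trans y*G≡G (sym (*-identityʳ G))))
      x^Q≡x : x ^ suc (suc s) ≡ x
      x^Q≡x = trans (cong (x *_) y≡1) (*-identityʳ x)

  Q≤length-Fq-elements : ∀ s t → size ≡ suc (suc s ℕ.* suc t) → suc (suc s) ≤ length (Fq-elements F (suc (suc s)))
  Q≤length-Fq-elements s t size≡ = k+r≡1+s[1+t]∧r≤ts⇒1+s≤k
    (trans (length-filter+length-filter-∁ fixed? elements) size≡) R≤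
    where
    fixed? : Decidable (InFq F (suc (suc s)))
    fixed? x = (x ^ suc (suc s)) ≟ x
    K R : List Carrier
    K = Fq-elements F (suc (suc s))
    R = filter (∁? fixed?) elements
    R≤ : length R ≤ t ℕ.* suc s
    R≤ = subst (length R ≤_) (length-geometric s t)
      (roots≤degree 1# (geometric s t) (λ { (1≡0 ∷ _) → 1≢0 1≡0 }) (Unique.filter⁺ _ unique)
        (All.tabulate λ x∈R → nonfixed-root s t size≡ (proj₂ (∈-filter⁻ (∁? fixed?) {xs = elements} x∈R))))

  length-Fq-elements : ∀ Q m → 2 ≤ Q → 1 ≤ m → size ≡ Q ℕ.^ m → length (Fq-elements F Q) ≡ Q
  length-Fq-elements (suc zero)    m       (s≤s ()) _ _
  length-Fq-elements (suc (suc s)) (suc f) _        _ size≡ with [1+s]^[1+f]≡1+s*[1+t] (suc s) f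
  ... | t , Q^[1+f]≡ = ℕ.≤-antisym (length-Fq-elements≤ s) (Q≤length-Fq-elements s t (trans size≡ Q^[1+f]≡))

  -- Subfields of fixed points and linear algebra over them

  record IsSubfield (S : Carrier → Set) : Set where
    field
      0∈        : S 0#
      +-closed  : ∀ {x y} → S x → S y → S (x + y)
      -‿closed  : ∀ {x} → S x → S (- x)
      *-closed  : ∀ {x y} → S x → S y → S (x * y)
      ⁻¹-closed : ∀ {x} → x ≢ 0# → S x → S (x ⁻¹)

  additive⇒isSubfield : ∀ {Q} → 1 ≤ Q → Additive Q → IsSubfield (InFq F Q)
  additive⇒isSubfield {suc Q} _ additive = record
    { 0∈        = zeroˡ _
    ; +-closed  = λ {x} {y} x^Q≡x y^Q≡y → trans (additive x y) (cong₂ _+_ x^Q≡x y^Q≡y)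
    ; -‿closed  = λ {x} x^Q≡x → trans (+-inverseʳ-unique (x ^ suc Q) _ (begin
        x ^ suc Q + (- x) ^ suc Q    ≡⟨ additive x (- x) ⟨
        (x + - x) ^ suc Q            ≡⟨ cong (_^ suc Q) (-‿inverseʳ x) ⟩
        0# ^ suc Q                   ≡⟨ zeroˡ _ ⟩
        0#                           ∎)) (cong -_ x^Q≡x)
    ; *-closed  = λ {x} {y} x^Q≡x y^Q≡y → trans (^-distrib-* x y (suc Q)) (cong₂ _*_ x^Q≡x y^Q≡y)
    ; ⁻¹-closed = λ {x} x≢0 x^Q≡x → trans (⁻¹-^ x (suc Q) x≢0) (cong _⁻¹ x^Q≡x)
    }

  fixed-isSubfield : ∀ {p m} → Prime p → size ≡ p ℕ.^ m → ∀ {Q} j → Q ≡ p ℕ.^ j → IsSubfield (InFq F Q)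
  fixed-isSubfield {p} {m} p-prime size≡p^m j refl = additive⇒isSubfield (ℕ.m^n>0 p {{prime⇒nonZero p-prime}} j)
    (frobenius-^ p-prime (size≡p^m⇒p·1≡0 {p} {m} size≡p^m) j)

  -- Q is only the (irrelevant) parameter of tuples in Defs
  module _ (Q : ℕ) {A : Set} where

    ∈-tuples⁻ : ∀ k {xs : List A} {c} → c ∈ tuples F Q k xs → ∀ i → c i ∈ xs
    ∈-tuples⁻ (suc k) {xs} c∈ i with find (∈-concatMap⁻ _ {xs = xs} c∈)
    ... | x , x∈xs , c∈map with ∈-map⁻ _ c∈map | i
    ... | t , t∈ , refl | zero  = x∈xs
    ... | t , t∈ , refl | suc j = ∈-tuples⁻ k t∈ j

    ∈-tuples⁺ : ∀ k {xs : List A} (c : Fin k → A) → (∀ i → c i ∈ xs) →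
                ∃ λ c′ → c′ ∈ tuples F Q k xs × (∀ i → c′ i ≡ c i)
    ∈-tuples⁺ zero    c _    = _ , here refl , λ ()
    ∈-tuples⁺ (suc k) c c∈xs with ∈-tuples⁺ k (c ∘ suc) (c∈xs ∘ suc)
    ... | t , t∈ , t≗c =
      _ , ∈-concatMap⁺ _ (lose (c∈xs zero) (∈-map⁺ _ t∈)) , λ { zero → refl ; (suc i) → t≗c i }

    length-tuples : ∀ k (xs : List A) → length (tuples F Q k xs) ≡ length xs ℕ.^ k
    length-tuples zero    xs = refl
    length-tuples (suc k) xs =
      length-concatMap _ (λ x → trans (List.length-map _ (tuples F Q k xs)) (length-tuples k xs)) xs

    unique-map-tuples : ∀ {B : Set} k {xs : List A} (h : (Fin k → A) → B) → Unique xs →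
      (∀ {c c′} → (∀ i → c i ∈ xs) → (∀ i → c′ i ∈ xs) → h c ≡ h c′ → ∀ i → c i ≡ c′ i) →
      Unique (map h (tuples F Q k xs))
    unique-map-tuples zero    h _ _ = [] ∷ []
    unique-map-tuples (suc k) {xs} h u h-injective =
      subst Unique (sym (List.map-concatMap h _ xs)) (unique-concatMap _ u each-unique disjoint)
      where
      each-unique : ∀ {x} → x ∈ xs → Unique (map h (map _ (tuples F Q k xs)))
      each-unique x∈xs = subst Unique (List.map-∘ (tuples F Q k xs))
        (unique-map-tuples k _ u λ c∈ c′∈ eq i →
          h-injective (λ { zero → x∈xs ; (suc j) → c∈ j }) (λ { zero → x∈xs ; (suc j) → c′∈ j }) eq (suc i))
      disjoint : ∀ {x y b} → x ∈ xs → y ∈ xs →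
                 b ∈ map h (map _ (tuples F Q k xs)) → b ∈ map h (map _ (tuples F Q k xs)) → x ≡ y
      disjoint x∈xs y∈xs b∈x b∈y with ∈-map⁻ h b∈x | ∈-map⁻ h b∈y
      ... | c , c∈ , refl | c′ , c′∈ , hc≡hc′ with ∈-map⁻ _ c∈ | ∈-map⁻ _ c′∈
      ... | t , t∈ , refl | t′ , t′∈ , refl = h-injective
        (λ { zero → x∈xs ; (suc j) → ∈-tuples⁻ k t∈ j })
        (λ { zero → y∈xs ; (suc j) → ∈-tuples⁻ k t′∈ j }) hc≡hc′ zero

  private
    module VecSum = SemiringSum semiring

    ∑≡sum : ∀ r (f : Fin r → Carrier) → ∑ r f ≡ VecSum.sum f
    ∑≡sum zero    f = refl
    ∑≡sum (suc r) f = cong (f zero +_) (∑≡sum r (f ∘ suc))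

  ∑-cong : ∀ r {f g : Fin r → Carrier} → (∀ i → f i ≡ g i) → ∑ r f ≡ ∑ r g
  ∑-cong r {f} {g} f≗g = trans (∑≡sum r f) (trans (VecSum.sum-cong-≗ f≗g) (sym (∑≡sum r g)))

  ∑-distrib-+ : ∀ r (f g : Fin r → Carrier) → ∑ r (λ i → f i + g i) ≡ ∑ r f + ∑ r g
  ∑-distrib-+ r f g =
    trans (∑≡sum r _) (trans (VecSum.∑-distrib-+ f g) (sym (cong₂ _+_ (∑≡sum r f) (∑≡sum r g))))

  *-distribˡ-∑ : ∀ r a (f : Fin r → Carrier) → a * ∑ r f ≡ ∑ r (λ i → a * f i)
  *-distribˡ-∑ r a f = trans (cong (a *_) (∑≡sum r f)) (trans (VecSum.*-distribˡ-sum a f) (sym (∑≡sum r _)))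

  lincomb : ∀ {r} → (Fin r → Carrier) → (Fin r → Carrier) → Carrier
  lincomb {r} c w = ∑ r (λ i → c i * w i)

  lincomb-cong : ∀ {r} {c c′ : Fin r → Carrier} w → (∀ i → c i ≡ c′ i) → lincomb c w ≡ lincomb c′ w
  lincomb-cong {r} w c≗c′ = ∑-cong r (λ i → cong (_* w i) (c≗c′ i))

  lincomb-+ : ∀ {r} (c c′ w : Fin r → Carrier) → lincomb (λ i → c i + c′ i) w ≡ lincomb c w + lincomb c′ w
  lincomb-+ {r} c c′ w = trans (∑-cong r (λ i → distribʳ (w i) (c i) (c′ i))) (∑-distrib-+ r _ _)

  lincomb-* : ∀ {r} a (c w : Fin r → Carrier) → lincomb (λ i → a * c i) w ≡ a * lincomb c w
  lincomb-* {r} a c w = trans (∑-cong r (λ i → *-assoc a (c i) (w i))) (sym (*-distribˡ-∑ r a _))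

  lincomb-0 : ∀ {r} (w : Fin r → Carrier) → lincomb (λ _ → 0#) w ≡ 0#
  lincomb-0 w = trans (lincomb-cong w (λ _ → sym (zeroˡ 0#))) (trans (lincomb-* 0# (λ _ → 0#) w) (zeroˡ _))

  lincomb-neg : ∀ {r} (c w : Fin r → Carrier) → lincomb (λ i → - c i) w ≡ - lincomb c w
  lincomb-neg c w = trans (lincomb-cong w (λ i → sym (-1*x≈-x (c i)))) (trans (lincomb-* (- 1#) c w) (-1*x≈-x _))

  module Span (Q : ℕ) (isSubfield : IsSubfield (InFq F Q)) where

    open IsSubfield isSubfield

    span : ∀ r → (Fin r → Carrier) → List Carrier
    span r w = map (λ c → lincomb c w) (tuples F Q r (Fq-elements F Q))

    ∈-span⁺ : ∀ {r} w {c : Fin r → Carrier} → (∀ i → InFq F Q (c i)) → lincomb c w ∈ span r w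
    ∈-span⁺ {r} w {c} c∈Fq with ∈-tuples⁺ Q r c (∈-Fq-elements⁺ Q ∘ c∈Fq)
    ... | c′ , c′∈ , c′≗c = subst (_∈ span r w) (lincomb-cong w c′≗c) (∈-map⁺ _ c′∈)

    ∈-span⁻ : ∀ {r} w {x} → x ∈ span r w → ∃ λ c → (∀ i → InFq F Q (c i)) × x ≡ lincomb c w
    ∈-span⁻ {r} w x∈ with ∈-map⁻ _ x∈
    ... | c , c∈ , x≡ = c , ∈-Fq-elements⁻ Q ∘ ∈-tuples⁻ Q r c∈ , x≡

    length-span : ∀ r w → length (span r w) ≡ length (Fq-elements F Q) ℕ.^ r
    length-span r w = trans (List.length-map _ (tuples F Q r _)) (length-tuples Q r _)

    lincomb-injective : ∀ {r w} → FqIndependent F Q r w → ∀ {c c′} →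
                        (∀ i → InFq F Q (c i)) → (∀ i → InFq F Q (c′ i)) →
                        lincomb c w ≡ lincomb c′ w → ∀ i → c i ≡ c′ i
    lincomb-injective {r} {w} w-independent {c} {c′} c∈Fq c′∈Fq eq i =
      x∙y⁻¹≈ε⇒x≈y _ _ (w-independent (λ j → c j - c′ j) (λ j → +-closed (c∈Fq j) (-‿closed (c′∈Fq j))) (begin
        lincomb (λ j → c j - c′ j) w             ≡⟨ lincomb-+ c (λ j → - c′ j) w ⟩
        lincomb c w + lincomb (λ j → - c′ j) w   ≡⟨ cong (lincomb c w +_) (lincomb-neg c′ w) ⟩
        lincomb c w - lincomb c′ w               ≡⟨ cong (_- lincomb c′ w) eq ⟩
        lincomb c′ w - lincomb c′ w              ≡⟨ -‿inverseʳ _ ⟩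
        0#                                       ∎) i)

    span-unique : ∀ {r w} → FqIndependent F Q r w → Unique (span r w)
    span-unique {r} w-independent = unique-map-tuples Q r _ (Unique.filter⁺ _ unique) λ c∈ c′∈ →
      lincomb-injective w-independent (∈-Fq-elements⁻ Q ∘ c∈) (∈-Fq-elements⁻ Q ∘ c′∈)

    0∈span : ∀ {r} w → 0# ∈ span r w
    0∈span w = subst (_∈ span _ w) (lincomb-0 w) (∈-span⁺ w (λ _ → 0∈))

    +-∈span : ∀ {r w x y} → x ∈ span r w → y ∈ span r w → x + y ∈ span r w
    +-∈span {r} {w} x∈ y∈ with ∈-span⁻ w x∈ | ∈-span⁻ w y∈
    ... | c , c∈Fq , refl | c′ , c′∈Fq , refl =
      subst (_∈ span r w) (lincomb-+ c c′ w) (∈-span⁺ w (λ i → +-closed (c∈Fq i) (c′∈Fq i)))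

    *-∈span : ∀ {r w a x} → InFq F Q a → x ∈ span r w → a * x ∈ span r w
    *-∈span {r} {w} {a} a∈Fq x∈ with ∈-span⁻ w x∈
    ... | c , c∈Fq , refl = subst (_∈ span r w) (lincomb-* a c w) (∈-span⁺ w (λ i → *-closed a∈Fq (c∈Fq i)))

    lincomb-∈span : ∀ {r w s} {c u : Fin s → Carrier} → (∀ i → InFq F Q (c i)) → (∀ i → u i ∈ span r w) →
                    lincomb c u ∈ span r w
    lincomb-∈span {s = zero}  _    _    = 0∈span _
    lincomb-∈span {s = suc s} c∈Fq u∈ =
      +-∈span (*-∈span (c∈Fq zero) (u∈ zero)) (lincomb-∈span (c∈Fq ∘ suc) (u∈ ∘ suc))

    extend : ∀ {r w t} → FqIndependent F Q r w → t ∉ span r w → FqIndependent F Q (suc r) (t Vector.∷ w)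
    extend {r} {w} {t} w-independent t∉span c c∈Fq c₀t+X≡0 = λ where
        zero    → c₀≡0
        (suc i) → w-independent (c ∘ suc) (c∈Fq ∘ suc) X≡0 i
      where
      c₀ X : Carrier
      c₀ = c zero
      X = lincomb (c ∘ suc) w
      c₀≡0 : c₀ ≡ 0#
      c₀≡0 with c₀ ≟ 0#
      ... | yes c₀≡0 = c₀≡0
      ... | no  c₀≢0 = contradiction (subst (_∈ span r w) t≡ (∈-span⁺ w d∈Fq)) t∉span
        where
        d∈Fq : ∀ i → InFq F Q (- (c₀ ⁻¹) * c (suc i))
        d∈Fq i = *-closed (-‿closed (⁻¹-closed c₀≢0 (c∈Fq zero))) (c∈Fq (suc i))
        t≡ : lincomb (λ i → - (c₀ ⁻¹) * c (suc i)) w ≡ t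
        t≡ = begin
          lincomb (λ i → - (c₀ ⁻¹) * c (suc i)) w   ≡⟨ lincomb-* (- (c₀ ⁻¹)) (c ∘ suc) w ⟩
          - (c₀ ⁻¹) * X                             ≡⟨ -‿distribˡ-* (c₀ ⁻¹) X ⟨
          - (c₀ ⁻¹ * X)                             ≡⟨ -‿distribʳ-* (c₀ ⁻¹) X ⟩
          c₀ ⁻¹ * - X                               ≡⟨ cong (c₀ ⁻¹ *_) (+-inverseˡ-unique _ _ c₀t+X≡0) ⟨
          c₀ ⁻¹ * (c₀ * t)                          ≡⟨ *-assoc _ _ _ ⟨
          (c₀ ⁻¹ * c₀) * t                          ≡⟨ cong (_* t) (inverseˡ c₀ c₀≢0) ⟩
          1# * t                                    ≡⟨ *-identityˡ t ⟩
          t                                         ∎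
      X≡0 : X ≡ 0#
      X≡0 = begin
        X               ≡⟨ +-identityˡ X ⟨
        0# + X          ≡⟨ cong (_+ X) (trans (cong (_* t) c₀≡0) (zeroˡ t)) ⟨
        c₀ * t + X      ≡⟨ c₀t+X≡0 ⟩
        0#              ∎

    independent-in : 1 < length (Fq-elements F Q) → ∀ {ts} → Unique ts →
                     ∀ m → length (Fq-elements F Q) ℕ.^ m ≤ length ts →
                     ∃ λ w → (∀ i → w i ∈ ts) × FqIndependent F Q m w
    independent-in _   _ zero    _ = (λ ()) , (λ ()) , (λ _ _ _ ())
    independent-in 1<K {ts} ts-unique (suc m) K^[1+m]≤ts =
      extend-in (independent-in 1<K ts-unique m (ℕ.<⇒≤ K^m<ts))
      where
      K^m<ts : length (Fq-elements F Q) ℕ.^ m < length ts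
      K^m<ts = ℕ.<-≤-trans (ℕ.^-monoʳ-< _ 1<K (ℕ.n<1+n m)) K^[1+m]≤ts
      extend-in : (∃ λ w → (∀ i → w i ∈ ts) × FqIndependent F Q m w) →
                  ∃ λ w → (∀ i → w i ∈ ts) × FqIndependent F Q (suc m) w
      extend-in (w , w∈ts , w-independent)
        with longer⇒∃∉ _≟_ ts-unique (subst (_< length ts) (sym (length-span m w)) K^m<ts)
      ... | t , t∈ts , t∉span =
        t Vector.∷ w , (λ { zero → t∈ts ; (suc i) → w∈ts i }) , extend w-independent t∉span

  -- The sum of g over a stable subspace

  g-0 : ∀ q → g F q 0# ≡ 0#
  g-0 q with 0# ≟ 0#
  ... | yes _   = refl
  ... | no  0≢0 = contradiction refl 0≢0

  g-≢0 : ∀ q {x} → x ≢ 0# → g F q x ≡ (x ^ (q ∸ 1)) ⁻¹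
  g-≢0 q {x} x≢0 with x ≟ 0#
  ... | yes x≡0 = contradiction x≡0 x≢0
  ... | no  _   = refl

  g-homogeneous : ∀ q {α} → α ≢ 0# → ∀ x → g F q (α * x) ≡ (α ^ (q ∸ 1)) ⁻¹ * g F q x
  g-homogeneous q {α} α≢0 x = by-cases (x ≟ 0#)
    where
    μ : Carrier
    μ = (α ^ (q ∸ 1)) ⁻¹
    by-cases : Dec (x ≡ 0#) → g F q (α * x) ≡ μ * g F q x
    by-cases (yes x≡0) = begin
      g F q (α * x)       ≡⟨ cong (λ y → g F q (α * y)) x≡0 ⟩
      g F q (α * 0#)      ≡⟨ cong (g F q) (zeroʳ α) ⟩
      g F q 0#            ≡⟨ g-0 q ⟩
      0#                  ≡⟨ zeroʳ μ ⟨
      μ * 0#              ≡⟨ cong (μ *_) (trans (cong (g F q) x≡0) (g-0 q)) ⟨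
      μ * g F q x         ∎
    by-cases (no x≢0) = begin
      g F q (α * x)                          ≡⟨ g-≢0 q (x≢0∧y≢0⇒x*y≢0 α≢0 x≢0) ⟩
      ((α * x) ^ (q ∸ 1)) ⁻¹                 ≡⟨ cong _⁻¹ (^-distrib-* α x (q ∸ 1)) ⟩
      (α ^ (q ∸ 1) * x ^ (q ∸ 1)) ⁻¹
        ≡⟨ ⁻¹-distrib-* _ _ (x≢0⇒x^n≢0 (q ∸ 1) α≢0) (x≢0⇒x^n≢0 (q ∸ 1) x≢0) ⟩
      μ * (x ^ (q ∸ 1)) ⁻¹                   ≡⟨ cong (μ *_) (g-≢0 q x≢0) ⟨
      μ * g F q x                            ∎

  sum-homogeneous≡0 : ∀ {h : Carrier → Carrier} {α μ xs} → (∀ x → h (α * x) ≡ μ * h x) → μ ≢ 1# →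
                      map (α *_) xs ↭ xs → sum (map h xs) ≡ 0#
  sum-homogeneous≡0 {h} {α} {μ} {xs} h-homogeneous μ≢1 αxs↭xs with sum (map h xs) ≟ 0#
  ... | yes S≡0 = S≡0
  ... | no  S≢0 = contradiction (*-cancelˡ μ 1# S≢0 (trans (*-comm _ μ) (trans μS≡S (sym (*-identityʳ _))))) μ≢1
    where
    μS≡S : μ * sum (map h xs) ≡ sum (map h xs)
    μS≡S = begin
      μ * sum (map h xs)              ≡⟨ sum-map-* μ (map h xs) ⟨
      sum (map (μ *_) (map h xs))     ≡⟨ cong sum (List.map-∘ xs) ⟨
      sum (map (λ x → μ * h x) xs)    ≡⟨ cong sum (List.map-cong (sym ∘ h-homogeneous) xs) ⟩
      sum (map (h ∘ (α *_)) xs)       ≡⟨ cong sum (List.map-∘ xs) ⟩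
      sum (map h (map (α *_) xs))     ≡⟨ sum-↭ (↭.map⁺ h αxs↭xs) ⟩
      sum (map h xs)                  ∎

  sum-g≡0 : ∀ q {α xs} → 1 ≤ q → α ^ q ≢ α → map (α *_) xs ↭ xs → sum (map (g F q) xs) ≡ 0#
  sum-g≡0 (suc q′) {α} 1≤q α^q≢α αxs↭xs = sum-homogeneous≡0 (g-homogeneous (suc q′) α≢0) μ≢1 αxs↭xs
    where
    α≢0 : α ≢ 0#
    α≢0 = x^q≢x⇒x≢0 (suc q′) 1≤q α^q≢α
    μ≢1 : (α ^ q′) ⁻¹ ≢ 1#
    μ≢1 μ≡1 = α^q≢α (begin
      α * α ^ q′                  ≡⟨ *-identityʳ _ ⟨
      α * α ^ q′ * 1#             ≡⟨ cong (α * α ^ q′ *_) μ≡1 ⟨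
      α * α ^ q′ * (α ^ q′) ⁻¹    ≡⟨ *-assoc _ _ _ ⟩
      α * (α ^ q′ * (α ^ q′) ⁻¹)  ≡⟨ cong (α *_) (inverseʳ _ (x≢0⇒x^n≢0 q′ α≢0)) ⟩
      α * 1#                      ≡⟨ *-identityʳ α ⟩
      α                           ∎)

  InFq-^ : ∀ {q x} d → InFq F q x → InFq F (q ℕ.^ d) x
  InFq-^ {x = x} zero    _ = *-identityʳ x
  InFq-^ {q} {x} (suc d) x^q≡x = begin
    x ^ (q ℕ.* q ℕ.^ d)    ≡⟨ ^-assocʳ x q (q ℕ.^ d) ⟨
    (x ^ q) ^ (q ℕ.^ d)    ≡⟨ cong (_^ (q ℕ.^ d)) x^q≡x ⟩
    x ^ (q ℕ.^ d)          ≡⟨ InFq-^ d x^q≡x ⟩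
    x                      ∎

  module _ {q d : ℕ} (Fq-isSubfield : IsSubfield (InFq F q)) (Fqᵈ-isSubfield : IsSubfield (InFq F (q ℕ.^ d)))
           (|Fq|≡q : length (Fq-elements F q) ≡ q) (|Fqᵈ|≡qᵈ : length (Fq-elements F (q ℕ.^ d)) ≡ q ℕ.^ d)
           (1<q : 1 < q) (1<d : 1 < d) where

    private
      module Fq  = Span q Fq-isSubfield
      module Fqᵈ = Span (q ℕ.^ d) Fqᵈ-isSubfield

      q<qᵈ : q < q ℕ.^ d
      q<qᵈ = subst (_< q ℕ.^ d) (ℕ.^-identityʳ q) (ℕ.^-monoʳ-< q 1<q 1<d)

      [qᵈ]^m≡q^[md] : ∀ m → (q ℕ.^ d) ℕ.^ m ≡ q ℕ.^ (m ℕ.* d)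
      [qᵈ]^m≡q^[md] m = trans (ℕ.^-*-assoc q d m) (cong (q ℕ.^_) (ℕ.*-comm d m))

      length-Fqᵈ-span : ∀ m w → length (Fqᵈ.span m w) ≡ q ℕ.^ (m ℕ.* d)
      length-Fqᵈ-span m w = trans (Fqᵈ.length-span m w) (trans (cong (ℕ._^ m) |Fqᵈ|≡qᵈ) ([qᵈ]^m≡q^[md] m))

    ∃-Fqᵈ∖Fq : ∃ λ α → InFq F (q ℕ.^ d) α × α ^ q ≢ α
    ∃-Fqᵈ∖Fq with longer⇒∃∉ _≟_ (Unique.filter⁺ _ unique) (subst₂ _<_ (sym |Fq|≡q) (sym |Fqᵈ|≡qᵈ) q<qᵈ)
    ... | α , α∈Fqᵈ , α∉Fq =
      α , ∈-Fq-elements⁻ (q ℕ.^ d) α∈Fqᵈ , α∉Fq ∘ ∈-Fq-elements⁺ q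

    Fqᵈ-independent : ∀ m → q ℕ.^ (m ℕ.* d) ≤ size → ∃ (FqIndependent F (q ℕ.^ d) m)
    Fqᵈ-independent m q^md≤size with Fqᵈ.independent-in 1<|Fqᵈ| unique m |Fqᵈ|^m≤size
      where
      1<|Fqᵈ| : 1 < length (Fq-elements F (q ℕ.^ d))
      1<|Fqᵈ| = subst (1 <_) (sym |Fqᵈ|≡qᵈ) (ℕ.<-trans 1<q q<qᵈ)
      |Fqᵈ|^m≤size : length (Fq-elements F (q ℕ.^ d)) ℕ.^ m ≤ length elements
      |Fqᵈ|^m≤size = subst (_≤ size) (sym (trans (cong (ℕ._^ m) |Fqᵈ|≡qᵈ) ([qᵈ]^m≡q^[md] m))) q^md≤size
    ... | w , _ , w-independent = w , w-independent

    Fq-basis : ∀ {m w} → FqIndependent F (q ℕ.^ d) m w →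
               ∃ λ v → FqIndependent F q (m ℕ.* d) v × (∀ {x} → x ∈ Fqᵈ.span m w → x ∈ Fq.span (m ℕ.* d) v)
                                                      × (∀ {x} → x ∈ Fq.span (m ℕ.* d) v → x ∈ Fqᵈ.span m w)
    Fq-basis {m} {w} w-independent with Fq.independent-in 1<|Fq| (Fqᵈ.span-unique w-independent) (m ℕ.* d) |Fq|^md≤|V|
      where
      1<|Fq| : 1 < length (Fq-elements F q)
      1<|Fq| = subst (1 <_) (sym |Fq|≡q) 1<q
      |Fq|^md≤|V| : length (Fq-elements F q) ℕ.^ (m ℕ.* d) ≤ length (Fqᵈ.span m w)
      |Fq|^md≤|V| = ℕ.≤-reflexive (trans (cong (ℕ._^ (m ℕ.* d)) |Fq|≡q) (sym (length-Fqᵈ-span m w)))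
    ... | v , v∈V , v-independent = v , v-independent , V⊆L , L⊆V
      where
      L⊆V : ∀ {x} → x ∈ Fq.span (m ℕ.* d) v → x ∈ Fqᵈ.span m w
      L⊆V x∈L with Fq.∈-span⁻ v x∈L
      ... | c , c∈Fq , refl = Fqᵈ.lincomb-∈span (InFq-^ d ∘ c∈Fq) v∈V
      V⊆L : ∀ {x} → x ∈ Fqᵈ.span m w → x ∈ Fq.span (m ℕ.* d) v
      V⊆L = unique⊆∧length≥⇒⊇ _≟_ (Fq.span-unique v-independent) L⊆V
        (ℕ.≤-reflexive (trans (length-Fqᵈ-span m w)
          (sym (trans (Fq.length-span (m ℕ.* d) v) (cong (ℕ._^ (m ℕ.* d)) |Fq|≡q)))))

    stable-subspace : ∀ {k} → d ∣ k → q ℕ.^ k ≤ size →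
                      ∃ λ v → FqIndependent F q k v × ∃ λ α → α ^ q ≢ α × map (α *_) (Fq.span k v) ↭ Fq.span k v
    stable-subspace (divides m refl) q^k≤size with Fqᵈ-independent m q^k≤size | ∃-Fqᵈ∖Fq
    ... | w , w-independent | α , α∈Fqᵈ , α^q≢α with Fq-basis w-independent
    ... | v , v-independent , V⊆L , L⊆V =
      v , v-independent , α , α^q≢α ,
      scaling-↭ α≢0 (Fq.span-unique v-independent) (L-closed α∈Fqᵈ) (L-closed (⁻¹-closed α≢0 α∈Fqᵈ))
      where
      open IsSubfield Fqᵈ-isSubfield using (⁻¹-closed)
      α≢0 : α ≢ 0#
      α≢0 = x^q≢x⇒x≢0 q (ℕ.<⇒≤ 1<q) α^q≢α
      L-closed : ∀ {a x} → InFq F (q ℕ.^ d) a → x ∈ Fq.span (m ℕ.* d) v → a * x ∈ Fq.span (m ℕ.* d) v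
      L-closed a∈Fqᵈ x∈L = V⊆L (Fqᵈ.*-∈span a∈Fqᵈ (L⊆V x∈L))

  module PrimePowerOrder {p e n} (p-prime : Prime p) (1≤e : 1 ≤ e) (1≤n : 1 ≤ n)
                         (size≡qⁿ : size ≡ (p ℕ.^ e) ℕ.^ n) where

    private
      q : ℕ
      q = p ℕ.^ e

      size≡pᵉⁿ : size ≡ p ℕ.^ (e ℕ.* n)
      size≡pᵉⁿ = trans size≡qⁿ (ℕ.^-*-assoc p e n)

    1<q : 1 < q
    1<q = ℕ.<-≤-trans (ℕ.nonTrivial⇒n>1 p {{prime⇒nonTrivial p-prime}})
      (subst (_≤ q) (ℕ.^-identityʳ p) (ℕ.^-monoʳ-≤ p {{prime⇒nonZero p-prime}} 1≤e))

    private
      q^-mono-≤ : ∀ {i j} → i ≤ j → q ℕ.^ i ≤ q ℕ.^ j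
      q^-mono-≤ = ℕ.^-monoʳ-≤ q {{ℕ.>-nonZero (ℕ.<-trans ℕ.z<s 1<q)}}

    qᵏ≤size : ∀ {k} → k ≤ n → q ℕ.^ k ≤ size
    qᵏ≤size {k} k≤n = subst (q ℕ.^ k ≤_) (sym size≡qⁿ) (q^-mono-≤ k≤n)

    Fq-isSubfield : IsSubfield (InFq F q)
    Fq-isSubfield = fixed-isSubfield {m = e ℕ.* n} p-prime size≡pᵉⁿ e refl

    Fqᵈ-isSubfield : ∀ d → IsSubfield (InFq F (q ℕ.^ d))
    Fqᵈ-isSubfield d = fixed-isSubfield {m = e ℕ.* n} p-prime size≡pᵉⁿ (e ℕ.* d) (ℕ.^-*-assoc p e d)

    |Fq|≡q : length (Fq-elements F q) ≡ q
    |Fq|≡q = length-Fq-elements q n 1<q 1≤n size≡qⁿ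

    |Fqᵈ|≡qᵈ : ∀ {d} → 1 ≤ d → d ∣ n → length (Fq-elements F (q ℕ.^ d)) ≡ q ℕ.^ d
    |Fqᵈ|≡qᵈ {d} 1≤d (divides f n≡fd) = length-Fq-elements (q ℕ.^ d) f 1<qᵈ 1≤f (begin
      size                ≡⟨ size≡qⁿ ⟩
      q ℕ.^ n             ≡⟨ cong (q ℕ.^_) (trans n≡fd (ℕ.*-comm f d)) ⟩
      q ℕ.^ (d ℕ.* f)     ≡⟨ ℕ.^-*-assoc q d f ⟨
      (q ℕ.^ d) ℕ.^ f     ∎)
      where
      1<qᵈ : 1 < q ℕ.^ d
      1<qᵈ = ℕ.<-≤-trans 1<q (subst (_≤ q ℕ.^ d) (ℕ.^-identityʳ q) (q^-mono-≤ 1≤d))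
      1≤f : 1 ≤ f
      1≤f = ℕ.n≢0⇒n>0 λ { refl → ℕ.<⇒≢ 1≤n (sym n≡fd) }

open import Data.Nat using (ℕ; _≤_; _<_; _^_)
open import Data.Nat.GCD using (gcd)
open import Relation.Nullary using (¬_)
open import Relation.Binary.PropositionalEquality using (_≡_)

proposition4p8 : (q n k : ℕ) → IsPrimePower q → 1 ≤ k → k ≤ n → 1 < gcd k n →
    (F : FiniteField) → FiniteField.size F ≡ q ^ n →
    ¬ SumFree F q k (g F q)
proposition4p8 .(p ^ e) n k (p , e , p-prime , 1≤e , refl) 1≤k k≤n 1<d F size≡qⁿ sum-free =
  let v , v-independent , α , α^q≢α , αL↭L =
        stable-subspace F Fq-isSubfield (Fqᵈ-isSubfield d) |Fq|≡q (|Fqᵈ|≡qᵈ (ℕ.<⇒≤ 1<d) (gcd[m,n]∣n k n))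
                        1<q 1<d (gcd[m,n]∣m k n) (qᵏ≤size k≤n)
  in sum-free 0# v v-independent (trans
       (cong (sum ∘ map (g F q)) (List.map-cong (λ _ → +-identityˡ _) (tuples F q k (Fq-elements F q))))
       (sum-g≡0 F q (ℕ.<⇒≤ 1<q) α^q≢α αL↭L))
  where
  open FiniteField F using (sum; 0#; isCommutativeRing)
  open IsCommutativeRing isCommutativeRing using (+-identityˡ)
  open PrimePowerOrder F p-prime 1≤e (ℕ.≤-trans 1≤k k≤n) size≡qⁿ
  q d : ℕ
  q = p ^ e
  d = gcd k n
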